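{- Let $L$ be a finite semimodular lattice with exactly two coatoms and $U$ a finite semimodular lattice with exactly two atoms. Then every vertical 2-sum of $L$ and $U$ is a semimodular lattice.
   Context: A finite lattice is (upper) semimodular if for all elements $s,t$: whenever $s$ and $t$ both cover $s\wedge t$, then $s\vee t$ covers both $s$ and $t$. With $\top_L$ the top of $L$, $\bot_U$ the bottom of $U$, $L'=L\setminus\{\top_L\}$ and $U'=U\setminus\{\bot_U\}$, a vertical 2-sum of $L$ and $U$ is the poset obtained from the disjoint union of $L'$ and $U'$ by identifying the two coatoms of $L$ with the two atoms of $U$ via some bijection, the order being the transitive closure of the union of the orders of $L'$ and $U'$. (Such a vertical 2-sum is always a lattice.) -}

module Defs where

open import Level using (0ℓ)
open import Data.Nat using (ℕ)
open import Data.Fin using (Fin)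
open import Data.Fin.Properties using (_≟_)
open import Data.Bool using (Bool; true; false; not; T) renaming (_∧_ to _and_)
open import Data.Product using (Σ; Σ-syntax; ∃; ∃-syntax; _×_; _,_; proj₁)
open import Data.Sum using (_⊎_; inj₁; inj₂)
open import Relation.Nullary using (¬_; yes; no)
open import Relation.Nullary.Decidable using (⌊_⌋)
open import Relation.Binary.Core using (Rel)
open import Relation.Binary.PropositionalEquality using (_≡_; _≢_)
open import Relation.Binary.Lattice.Structures using (IsLattice)
open import Relation.Binary.Construct.Closure.Transitive using (TransClosure)
open import Algebra.Core using (Op₂)

module _ {A : Set} (_≤_ : Rel A 0ℓ) where

  _<_ : Rel A 0ℓ
  x < y = (x ≤ y) × (x ≢ y)

  Covers : A → A → Set
  Covers x y = (x < y) × (∀ z → x < z → ¬ (z < y))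

  SemimodularOps : Op₂ A → Op₂ A → Set
  SemimodularOps _∨_ _∧_ =
    ∀ s t → Covers (s ∧ t) s → Covers (s ∧ t) t →
      Covers s (s ∨ t) × Covers t (s ∨ t)

  IsSemimodularLattice : Set
  IsSemimodularLattice =
    Σ[ _∨_ ∈ Op₂ A ] Σ[ _∧_ ∈ Op₂ A ]
      (IsLattice _≡_ _≤_ _∨_ _∧_ × SemimodularOps _∨_ _∧_)

record FinLattice : Set₁ where
  field
    size      : ℕ
    _≤_       : Rel (Fin size) 0ℓ
    _∨_       : Op₂ (Fin size)
    _∧_       : Op₂ (Fin size)
    isLattice : IsLattice _≡_ _≤_ _∨_ _∧_

open FinLattice public using (size)

Semimodular : FinLattice → Set
Semimodular L = SemimodularOps (FinLattice._≤_ L) (FinLattice._∨_ L) (FinLattice._∧_ L)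

-- Parameters: ⊤L the top of L, c₁ c₂ its coatoms, ⊥U the bottom of U,
-- a₁ a₂ its atoms; the bijection identifies c₁ with a₁ and c₂ with a₂.
-- Elements: L' = L ∖ {⊤L} (tagged inj₁) together with the elements of
-- U' = U ∖ {⊥U} other than the atoms (tagged inj₂); an atom aᵢ of U is
-- represented by the coatom cᵢ of L.

module VerticalSum (L U : FinLattice)
                   (⊤L c₁ c₂ : Fin (size L)) (⊥U a₁ a₂ : Fin (size U)) where

  private
    module L = FinLattice L
    module U = FinLattice U

  Raw : Set
  Raw = Fin (size L) ⊎ Fin (size U)

  valid : Raw → Bool
  valid (inj₁ x) = not ⌊ x ≟ ⊤L ⌋
  valid (inj₂ y) = not ⌊ y ≟ ⊥U ⌋ and (not ⌊ y ≟ a₁ ⌋ and not ⌊ y ≟ a₂ ⌋)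

  Elem : Set
  Elem = Σ Raw (λ p → T (valid p))

  ιU : Fin (size U) → Raw
  ιU y with y ≟ a₁
  ... | yes _ = inj₁ c₁
  ... | no _ with y ≟ a₂
  ...   | yes _ = inj₁ c₂
  ...   | no _ = inj₂ y

  Step : Rel Raw 0ℓ
  Step p q =
      (∃[ x ] ∃[ y ] (x ≢ ⊤L × y ≢ ⊤L × x L.≤ y × p ≡ inj₁ x × q ≡ inj₁ y))
    ⊎ (∃[ u ] ∃[ v ] (u ≢ ⊥U × v ≢ ⊥U × u U.≤ v × p ≡ ιU u × q ≡ ιU v))

  _≤ₛ_ : Rel Elem 0ℓ
  p ≤ₛ q = TransClosure Step (proj₁ p) (proj₁ q)

module Submission where

-- The order of the 2-sum is given as a transitive closure. We first replace it
-- by an explicit order _⊑_: lower elements (L ∖ {⊤L}) are ordered as in L, the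
-- remaining ("high") elements of U as in U, and x ⊑ v for lower x and high v
-- iff x ≤ cᵢ and aᵢ ≤ v for some i. Since covering, the lattice axioms and
-- semimodularity only depend on the order up to logical equivalence, it is
-- enough to work with _⊑_. There we write down joins and meets explicitly,
-- and check semimodularity by cases: covers among lower elements are covers
-- of L, covers among images of U ∖ {⊥U} are covers of U, no element is covered
-- by both a lower and a high element, and where the join in L would be ⊤L the
-- two covering elements are c₁ = a₁ and c₂ = a₂, both covered by a₁ ∨ a₂ by
-- semimodularity of U. Finiteness enters only to see that every element other
-- than ⊤L lies below a coatom and every element other than ⊥U above an atom.

open import Defs
open import Algebra.Core using (Op₂)
open import Level using (0ℓ)
open import Data.Bool using (T; not)
open import Data.Bool.Properties using (T-∧; T-irrelevant)
open import Data.Empty using (⊥; ⊥-elim)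
open import Data.Fin using (Fin)
open import Data.Fin.Properties using (_≟_)
open import Data.List using (List; []; _∷_; allFin)
open import Data.List.Membership.Propositional using (_∈_)
open import Data.List.Membership.Propositional.Properties using (∈-allFin)
open import Data.List.Relation.Unary.Any using (here; there)
open import Data.Nat using (ℕ)
open import Data.Product using (Σ-syntax; ∃-syntax; _×_; _,_; proj₁; proj₂)
open import Data.Sum using (_⊎_; inj₁; inj₂)
open import Data.Sum.Properties using (inj₁-injective)
open import Function using (_∘_; flip; Equivalence)
open import Relation.Binary.Construct.Closure.Transitive using (TransClosure; [_]; _∷_)
open import Relation.Binary.Core using (Rel)
open import Relation.Binary.Definitions using (Decidable; Transitive)
open import Relation.Binary.Lattice.Bundles using (Lattice)
open import Relation.Binary.Lattice.Structures using (IsLattice)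
open import Relation.Binary.PropositionalEquality
  using (_≡_; _≢_; refl; sym; trans; cong; subst; subst₂)
open import Relation.Nullary using (¬_; Dec; yes; no)
open import Relation.Nullary.Decidable using (⌊_⌋; ¬?; _×-dec_; toWitnessFalse; fromWitnessFalse)
import Relation.Binary.Construct.NonStrictToStrict as Strict
import Relation.Binary.Lattice.Properties.JoinSemilattice as JoinProps
import Relation.Binary.PropositionalEquality as Eq

module MinimalElements {n : ℕ} {_≺_ : Rel (Fin n) 0ℓ} (_≺?_ : Decidable _≺_)
                       (≺-trans : Transitive _≺_) (≺-irrefl : ∀ x → ¬ (x ≺ x))
                       {P : Fin n → Set} (P? : ∀ x → Dec (P x)) where

  Minimal : Fin n → Set
  Minimal m = P m × (∀ w → P w → ¬ (w ≺ m))

  minimal-in : (ws : List (Fin n)) (m : Fin n) → P m →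
               Σ[ m' ∈ Fin n ] P m' × (∀ w → w ∈ ws → P w → ¬ (w ≺ m'))
  minimal-in [] m pm = m , pm , λ _ ()
  minimal-in (w ∷ ws) m pm with minimal-in ws m pm
  ... | m' , pm' , min' with P? w | w ≺? m'
  ...   | yes pw | yes w≺m' = w , pw , min
    where
    min : ∀ z → z ∈ w ∷ ws → P z → ¬ (z ≺ w)
    min z (here refl) _  z≺w = ≺-irrefl z z≺w
    min z (there z∈) pz z≺w = min' z z∈ pz (≺-trans z≺w w≺m')
  ...   | yes _  | no w⊀m' = m' , pm' , min
    where
    min : ∀ z → z ∈ w ∷ ws → P z → ¬ (z ≺ m')
    min z (here refl) _  = w⊀m'
    min z (there z∈) pz = min' z z∈ pz
  ...   | no ¬pw | _ = m' , pm' , min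
    where
    min : ∀ z → z ∈ w ∷ ws → P z → ¬ (z ≺ m')
    min z (here refl) pz = ⊥-elim (¬pw pz)
    min z (there z∈) pz = min' z z∈ pz

  minimal : (m : Fin n) → P m → Σ[ m' ∈ Fin n ] Minimal m'
  minimal m pm with minimal-in (allFin n) m pm
  ... | m' , pm' , min = m' , pm' , λ w → min w (∈-allFin w)

module FinLatticeFacts (K : FinLattice) where
  open FinLattice K public using (_≤_; _∨_; _∧_; isLattice)
  open IsLattice isLattice public
    using (antisym; isPartialOrder; x≤x∨y; y≤x∨y; ∨-least; x∧y≤x; x∧y≤y; ∧-greatest)
    renaming (refl to ≤-refl; trans to ≤-trans)

  private
    Carrier : Set
    Carrier = Fin (size K)

  -- x ≤ y iff x ∨ y ≡ y, and equality of Fin is decidable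
  _≤?_ : Decidable _≤_
  _≤?_ = JoinProps.≈-dec⇒≤-dec (Lattice.joinSemilattice lattice) _≟_
    where
    lattice : Lattice 0ℓ 0ℓ 0ℓ
    lattice = record { isLattice = isLattice }

  _⊏_ : Rel Carrier 0ℓ
  _⊏_ = _<_ _≤_

  _⋖_ : Rel Carrier 0ℓ
  _⋖_ = Covers _≤_

  _⊏?_ : Decidable _⊏_
  _⊏?_ = Strict.<-decidable _≡_ _≤_ _≟_ _≤?_

  ⊏-trans : Transitive _⊏_
  ⊏-trans = Strict.<-trans _≡_ _≤_ isPartialOrder

  ⊏-irrefl : ∀ x → ¬ (x ⊏ x)
  ⊏-irrefl x = Strict.<-irrefl _≡_ _≤_ refl

  ¬self-meet-⋖ : ∀ x → ¬ ((x ∧ x) ⋖ x)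
  ¬self-meet-⋖ x ((_ , x∧x≢x) , _) = x∧x≢x (antisym (x∧y≤x x x) (∧-greatest ≤-refl ≤-refl))

  module Top (⊤ᴷ : Carrier) (≤⊤ᴷ : ∀ x → x ≤ ⊤ᴷ) where

    ≢⊤-downward : ∀ {x y} → x ≢ ⊤ᴷ → y ≤ x → y ≢ ⊤ᴷ
    ≢⊤-downward x≢⊤ y≤x refl = x≢⊤ (antisym (≤⊤ᴷ _) y≤x)

    coatom-maximal : ∀ {c w} → c ⋖ ⊤ᴷ → c ≤ w → w ≢ ⊤ᴷ → w ≡ c
    coatom-maximal {c} {w} (_ , between) c≤w w≢⊤ with w ≟ c
    ... | yes w≡c = w≡c
    ... | no  w≢c = ⊥-elim (between w (c≤w , λ c≡w → w≢c (sym c≡w)) (≤⊤ᴷ w , w≢⊤))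

    coatoms-incomparable : ∀ {c d} → c ⋖ ⊤ᴷ → d ⋖ ⊤ᴷ → c ≢ d → ¬ (c ≤ d)
    coatoms-incomparable c⋖⊤ (( _ , d≢⊤) , _) c≢d c≤d =
      c≢d (sym (coatom-maximal c⋖⊤ c≤d d≢⊤))

    -- finiteness: every element other than ⊤ᴷ lies below a coatom
    -- (a maximal element among those ≢ ⊤ᴷ above x)
    below-coatom : ∀ x → x ≢ ⊤ᴷ → ∃[ c ] c ⋖ ⊤ᴷ × x ≤ c
    below-coatom x x≢⊤ with Max.minimal x (x≢⊤ , ≤-refl)
      where
      module Max = MinimalElements {_≺_ = flip _⊏_} (flip _⊏?_) (flip ⊏-trans) ⊏-irrefl
                                   {P = λ z → z ≢ ⊤ᴷ × x ≤ z}
                                   (λ z → ¬? (z ≟ ⊤ᴷ) ×-dec (x ≤? z))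
    ... | c , (c≢⊤ , x≤c) , maximal =
      c , ((≤⊤ᴷ c , c≢⊤) , λ z c⊏z z⊏⊤ → maximal z (proj₂ z⊏⊤ , ≤-trans x≤c (proj₁ c⊏z)) c⊏z) , x≤c

  module Bottom (⊥ᴷ : Carrier) (⊥ᴷ≤ : ∀ x → ⊥ᴷ ≤ x) where

    atom-minimal : ∀ {a u} → ⊥ᴷ ⋖ a → u ≤ a → u ≢ ⊥ᴷ → u ≡ a
    atom-minimal {a} {u} (_ , between) u≤a u≢⊥ with u ≟ a
    ... | yes u≡a = u≡a
    ... | no  u≢a = ⊥-elim (between u (⊥ᴷ≤ u , λ ⊥≡u → u≢⊥ (sym ⊥≡u)) (u≤a , u≢a))

    atom-≢⊥ : ∀ {a} → ⊥ᴷ ⋖ a → a ≢ ⊥ᴷ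
    atom-≢⊥ ((_ , ⊥≢a) , _) a≡⊥ = ⊥≢a (sym a≡⊥)

    atoms-incomparable : ∀ {a b} → ⊥ᴷ ⋖ a → ⊥ᴷ ⋖ b → a ≢ b → ¬ (a ≤ b)
    atoms-incomparable ⊥⋖a ⊥⋖b a≢b a≤b = a≢b (atom-minimal ⊥⋖b a≤b (atom-≢⊥ ⊥⋖a))

    atoms-meet : ∀ {a b} → ⊥ᴷ ⋖ a → ⊥ᴷ ⋖ b → a ≢ b → (a ∧ b) ≡ ⊥ᴷ
    atoms-meet {a} {b} ⊥⋖a ⊥⋖b a≢b with (a ∧ b) ≟ ⊥ᴷ
    ... | yes a∧b≡⊥ = a∧b≡⊥
    ... | no  a∧b≢⊥ = ⊥-elim (a≢b (trans (sym (atom-minimal ⊥⋖a (x∧y≤x a b) a∧b≢⊥))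
                                         (atom-minimal ⊥⋖b (x∧y≤y a b) a∧b≢⊥)))

    above-atom : ∀ v → v ≢ ⊥ᴷ → ∃[ a ] ⊥ᴷ ⋖ a × a ≤ v
    above-atom v v≢⊥ with Min.minimal v (v≢⊥ , ≤-refl)
      where
      module Min = MinimalElements _⊏?_ ⊏-trans ⊏-irrefl
                                   {P = λ z → z ≢ ⊥ᴷ × z ≤ v}
                                   (λ z → ¬? (z ≟ ⊥ᴷ) ×-dec (z ≤? v))
    ... | a , (a≢⊥ , a≤v) , minimal =
      a , ((⊥ᴷ≤ a , λ ⊥≡a → a≢⊥ (sym ⊥≡a)) ,
           λ z ⊥⊏z z⊏a → minimal z ((λ z≡⊥ → proj₂ ⊥⊏z (sym z≡⊥)) , ≤-trans (proj₁ z⊏a) a≤v) z⊏a) ,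
      a≤v

covers-transport : ∀ {A : Set} {R S : Rel A 0ℓ} →
                   (∀ {x y} → R x y → S x y) → (∀ {x y} → S x y → R x y) →
                   ∀ {x y} → Covers R x y → Covers S x y
covers-transport R⇒S S⇒R ((r , x≢y) , between) =
  (R⇒S r , x≢y) , λ z (s₁ , n₁) (s₂ , n₂) → between z (S⇒R s₁ , n₁) (S⇒R s₂ , n₂)

isLattice-transport : ∀ {A : Set} {R S : Rel A 0ℓ} {_∨_ _∧_ : Op₂ A} →
                      (∀ {x y} → R x y → S x y) → (∀ {x y} → S x y → R x y) →
                      IsLattice _≡_ R _∨_ _∧_ → IsLattice _≡_ S _∨_ _∧_
isLattice-transport R⇒S S⇒R lat = record
  { isPartialOrder = record
    { isPreorder = record
      { isEquivalence = Eq.isEquivalence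
      ; reflexive     = λ { refl → R⇒S ≤-refl }
      ; trans         = λ s₁ s₂ → R⇒S (≤-trans (S⇒R s₁) (S⇒R s₂))
      }
    ; antisym = λ s₁ s₂ → antisym (S⇒R s₁) (S⇒R s₂)
    }
  ; supremum = λ x y → R⇒S (x≤x∨y x y) , R⇒S (y≤x∨y x y) ,
                       λ _ s₁ s₂ → R⇒S (∨-least (S⇒R s₁) (S⇒R s₂))
  ; infimum  = λ x y → R⇒S (x∧y≤x x y) , R⇒S (x∧y≤y x y) ,
                       λ _ s₁ s₂ → R⇒S (∧-greatest (S⇒R s₁) (S⇒R s₂))
  }
  where open IsLattice lat renaming (refl to ≤-refl; trans to ≤-trans)

semimodularLattice-transport : ∀ {A : Set} {R S : Rel A 0ℓ} →
                               (∀ {x y} → R x y → S x y) → (∀ {x y} → S x y → R x y) →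
                               IsSemimodularLattice R → IsSemimodularLattice S
semimodularLattice-transport R⇒S S⇒R (_∨_ , _∧_ , lat , semimodular) =
  _∨_ , _∧_ , isLattice-transport R⇒S S⇒R lat , λ s t s∧t⋖s s∧t⋖t →
    let s⋖s∨t , t⋖s∨t = semimodular s t (covers-transport S⇒R R⇒S s∧t⋖s)
                                        (covers-transport S⇒R R⇒S s∧t⋖t)
    in covers-transport R⇒S S⇒R s⋖s∨t , covers-transport R⇒S S⇒R t⋖s∨t

module VerticalSumProperties
    (L U : FinLattice) (smL : Semimodular L) (smU : Semimodular U)
    (⊤L c₁ c₂ : Fin (size L))
    (≤⊤L : ∀ x → FinLattice._≤_ L x ⊤L)
    (c₁≢c₂ : c₁ ≢ c₂)
    (c₁⋖⊤ : Covers (FinLattice._≤_ L) c₁ ⊤L) (c₂⋖⊤ : Covers (FinLattice._≤_ L) c₂ ⊤L)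
    (coatoms : ∀ c → Covers (FinLattice._≤_ L) c ⊤L → c ≡ c₁ ⊎ c ≡ c₂)
    (⊥U a₁ a₂ : Fin (size U))
    (⊥U≤ : ∀ y → FinLattice._≤_ U ⊥U y)
    (a₁≢a₂ : a₁ ≢ a₂)
    (⊥⋖a₁ : Covers (FinLattice._≤_ U) ⊥U a₁) (⊥⋖a₂ : Covers (FinLattice._≤_ U) ⊥U a₂)
    (atoms : ∀ a → Covers (FinLattice._≤_ U) ⊥U a → a ≡ a₁ ⊎ a ≡ a₂) where

  module L = FinLatticeFacts L
  module U = FinLatticeFacts U
  open L.Top ⊤L ≤⊤L
  open U.Bottom ⊥U ⊥U≤
  open VerticalSum L U ⊤L c₁ c₂ ⊥U a₁ a₂

  below-c₁-or-c₂ : ∀ x → x ≢ ⊤L → x L.≤ c₁ ⊎ x L.≤ c₂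
  below-c₁-or-c₂ x x≢⊤ with below-coatom x x≢⊤
  ... | c , c⋖⊤ , x≤c with coatoms c c⋖⊤
  ...   | inj₁ refl = inj₁ x≤c
  ...   | inj₂ refl = inj₂ x≤c

  above-a₁-or-a₂ : ∀ v → v ≢ ⊥U → a₁ U.≤ v ⊎ a₂ U.≤ v
  above-a₁-or-a₂ v v≢⊥ with above-atom v v≢⊥
  ... | a , ⊥⋖a , a≤v with atoms a ⊥⋖a
  ...   | inj₁ refl = inj₁ a≤v
  ...   | inj₂ refl = inj₂ a≤v

  c₁≢⊤ : c₁ ≢ ⊤L
  c₁≢⊤ = proj₂ (proj₁ c₁⋖⊤)

  c₂≢⊤ : c₂ ≢ ⊤L
  c₂≢⊤ = proj₂ (proj₁ c₂⋖⊤)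

  a₁≢⊥ : a₁ ≢ ⊥U
  a₁≢⊥ = atom-≢⊥ ⊥⋖a₁

  a₂≢⊥ : a₂ ≢ ⊥U
  a₂≢⊥ = atom-≢⊥ ⊥⋖a₂

  c₁≰c₂ : ¬ (c₁ L.≤ c₂)
  c₁≰c₂ = coatoms-incomparable c₁⋖⊤ c₂⋖⊤ c₁≢c₂

  c₂≰c₁ : ¬ (c₂ L.≤ c₁)
  c₂≰c₁ = coatoms-incomparable c₂⋖⊤ c₁⋖⊤ (c₁≢c₂ ∘ sym)

  a₁≰a₂ : ¬ (a₁ U.≤ a₂)
  a₁≰a₂ = atoms-incomparable ⊥⋖a₁ ⊥⋖a₂ a₁≢a₂

  a₂≰a₁ : ¬ (a₂ U.≤ a₁)
  a₂≰a₁ = atoms-incomparable ⊥⋖a₂ ⊥⋖a₁ (a₁≢a₂ ∘ sym)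

  High : Fin (size U) → Set
  High u = u ≢ ⊥U × u ≢ a₁ × u ≢ a₂

  High-upward : ∀ {u v} → High u → u U.≤ v → High v
  High-upward (u≢⊥ , u≢a₁ , u≢a₂) u≤v =
    (λ { refl → u≢⊥ (U.antisym u≤v (⊥U≤ _)) }) ,
    (λ { refl → u≢a₁ (atom-minimal ⊥⋖a₁ u≤v u≢⊥) }) ,
    (λ { refl → u≢a₂ (atom-minimal ⊥⋖a₂ u≤v u≢⊥) })

  High-above-atoms : ∀ {w} → a₁ U.≤ w → a₂ U.≤ w → High w
  High-above-atoms a₁≤w a₂≤w =
    (λ { refl → a₁≢⊥ (U.antisym a₁≤w (⊥U≤ _)) }) ,
    (λ { refl → a₂≰a₁ a₂≤w }) ,
    (λ { refl → a₁≰a₂ a₁≤w })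

  valid⇒≢⊤ : ∀ {x} → T (valid (inj₁ x)) → x ≢ ⊤L
  valid⇒≢⊤ = toWitnessFalse

  ≢⊤⇒valid : ∀ {x} → x ≢ ⊤L → T (valid (inj₁ x))
  ≢⊤⇒valid = fromWitnessFalse

  valid⇒High : ∀ {u} → T (valid (inj₂ u)) → High u
  valid⇒High {u} t =
    let t⊥ , tₐ = Equivalence.to (T-∧ {not ⌊ u ≟ ⊥U ⌋}) t
        t₁ , t₂ = Equivalence.to (T-∧ {not ⌊ u ≟ a₁ ⌋}) tₐ
    in toWitnessFalse t⊥ , toWitnessFalse t₁ , toWitnessFalse t₂

  High⇒valid : ∀ {u} → High u → T (valid (inj₂ u))
  High⇒valid {u} (u≢⊥ , u≢a₁ , u≢a₂) =
    Equivalence.from (T-∧ {not ⌊ u ≟ ⊥U ⌋}) (fromWitnessFalse u≢⊥ ,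
      Equivalence.from (T-∧ {not ⌊ u ≟ a₁ ⌋}) (fromWitnessFalse u≢a₁ , fromWitnessFalse u≢a₂))

  lo : (x : Fin (size L)) → x ≢ ⊤L → Elem
  lo x x≢⊤ = inj₁ x , ≢⊤⇒valid x≢⊤

  hi : (u : Fin (size U)) → High u → Elem
  hi u hu = inj₂ u , High⇒valid hu

  -- validity is a proposition, so elements are determined by their raw part
  Elem-≡ : {p q : Elem} → proj₁ p ≡ proj₁ q → p ≡ q
  Elem-≡ {p , tp} {.p , tq} refl = cong (p ,_) (T-irrelevant tp tq)

  data ιU-View (y : Fin (size U)) : Raw → Set where
    is-a₁   : y ≡ a₁ → ιU-View y (inj₁ c₁)
    is-a₂   : y ≡ a₂ → ιU-View y (inj₁ c₂)
    is-high : y ≢ a₁ → y ≢ a₂ → ιU-View y (inj₂ y)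

  ιU-view : ∀ y → ιU-View y (ιU y)
  ιU-view y with y ≟ a₁
  ... | yes y≡a₁ = is-a₁ y≡a₁
  ... | no y≢a₁ with y ≟ a₂
  ...   | yes y≡a₂ = is-a₂ y≡a₂
  ...   | no y≢a₂  = is-high y≢a₁ y≢a₂

  ιU-a₁ : ιU a₁ ≡ inj₁ c₁
  ιU-a₁ with ιU a₁ | ιU-view a₁
  ... | _ | is-a₁ _ = refl
  ... | _ | is-a₂ a₁≡a₂ = ⊥-elim (a₁≢a₂ a₁≡a₂)
  ... | _ | is-high a₁≢a₁ _ = ⊥-elim (a₁≢a₁ refl)

  ιU-a₂ : ιU a₂ ≡ inj₁ c₂
  ιU-a₂ with ιU a₂ | ιU-view a₂
  ... | _ | is-a₁ a₂≡a₁ = ⊥-elim (a₁≢a₂ (sym a₂≡a₁))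
  ... | _ | is-a₂ _ = refl
  ... | _ | is-high _ a₂≢a₂ = ⊥-elim (a₂≢a₂ refl)

  ιU-high : ∀ {u} → High u → ιU u ≡ inj₂ u
  ιU-high {u} (_ , u≢a₁ , u≢a₂) with ιU u | ιU-view u
  ... | _ | is-a₁ u≡a₁ = ⊥-elim (u≢a₁ u≡a₁)
  ... | _ | is-a₂ u≡a₂ = ⊥-elim (u≢a₂ u≡a₂)
  ... | _ | is-high _ _ = refl

  ιU-valid : ∀ u → u ≢ ⊥U → T (valid (ιU u))
  ιU-valid u u≢⊥ with ιU u | ιU-view u
  ... | _ | is-a₁ _ = ≢⊤⇒valid c₁≢⊤
  ... | _ | is-a₂ _ = ≢⊤⇒valid c₂≢⊤
  ... | _ | is-high u≢a₁ u≢a₂ = High⇒valid (u≢⊥ , u≢a₁ , u≢a₂)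

  ιE : (u : Fin (size U)) → u ≢ ⊥U → Elem
  ιE u u≢⊥ = ιU u , ιU-valid u u≢⊥

  -- the explicit order: lower elements are ordered as in L, high ones as in U,
  -- no high element lies below a lower one, and x lies below the high v iff
  -- x ≤ cᵢ and aᵢ ≤ v for some i (x passes through the identified cᵢ = aᵢ)

  _⊑_ : Rel Raw 0ℓ
  inj₁ x ⊑ inj₁ y = x L.≤ y
  inj₁ x ⊑ inj₂ v = (x L.≤ c₁ × a₁ U.≤ v) ⊎ (x L.≤ c₂ × a₂ U.≤ v)
  inj₂ u ⊑ inj₁ y = ⊥
  inj₂ u ⊑ inj₂ v = u U.≤ v

  ⊑-refl : ∀ p → p ⊑ p
  ⊑-refl (inj₁ x) = L.≤-refl
  ⊑-refl (inj₂ u) = U.≤-refl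

  ⊑-trans : ∀ p q r → p ⊑ q → q ⊑ r → p ⊑ r
  ⊑-trans (inj₁ x) (inj₁ y) (inj₁ z) x≤y y≤z = L.≤-trans x≤y y≤z
  ⊑-trans (inj₁ x) (inj₁ y) (inj₂ w) x≤y (inj₁ (y≤c₁ , a₁≤w)) = inj₁ (L.≤-trans x≤y y≤c₁ , a₁≤w)
  ⊑-trans (inj₁ x) (inj₁ y) (inj₂ w) x≤y (inj₂ (y≤c₂ , a₂≤w)) = inj₂ (L.≤-trans x≤y y≤c₂ , a₂≤w)
  ⊑-trans (inj₁ x) (inj₂ v) (inj₂ w) (inj₁ (x≤c₁ , a₁≤v)) v≤w = inj₁ (x≤c₁ , U.≤-trans a₁≤v v≤w)
  ⊑-trans (inj₁ x) (inj₂ v) (inj₂ w) (inj₂ (x≤c₂ , a₂≤v)) v≤w = inj₂ (x≤c₂ , U.≤-trans a₂≤v v≤w)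
  ⊑-trans (inj₂ u) (inj₂ v) (inj₂ w) u≤v v≤w = U.≤-trans u≤v v≤w
  ⊑-trans (inj₁ _) (inj₂ _) (inj₁ _) _ ()
  ⊑-trans (inj₂ _) (inj₂ _) (inj₁ _) _ ()
  ⊑-trans (inj₂ _) (inj₁ _) _ ()

  ιU-monotone : ∀ {u v} → u ≢ ⊥U → u U.≤ v → ιU u ⊑ ιU v
  ιU-monotone {u} {v} u≢⊥ u≤v with ιU u | ιU-view u | ιU v | ιU-view v
  ... | _ | is-a₁ refl | _ | is-a₁ _ = L.≤-refl
  ... | _ | is-a₁ refl | _ | is-a₂ refl = ⊥-elim (a₁≰a₂ u≤v)
  ... | _ | is-a₁ refl | _ | is-high _ _ = inj₁ (L.≤-refl , u≤v)
  ... | _ | is-a₂ refl | _ | is-a₁ refl = ⊥-elim (a₂≰a₁ u≤v)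
  ... | _ | is-a₂ refl | _ | is-a₂ _ = L.≤-refl
  ... | _ | is-a₂ refl | _ | is-high _ _ = inj₂ (L.≤-refl , u≤v)
  ... | _ | is-high u≢a₁ _ | _ | is-a₁ refl = ⊥-elim (u≢a₁ (atom-minimal ⊥⋖a₁ u≤v u≢⊥))
  ... | _ | is-high _ u≢a₂ | _ | is-a₂ refl = ⊥-elim (u≢a₂ (atom-minimal ⊥⋖a₂ u≤v u≢⊥))
  ... | _ | is-high _ _ | _ | is-high _ _ = u≤v

  ιU-reflects : ∀ {u v} → ιU u ⊑ ιU v → u U.≤ v
  ιU-reflects {u} {v} ιu⊑ιv with ιU u | ιU-view u | ιU v | ιU-view v
  ... | _ | is-a₁ refl | _ | is-a₁ refl = U.≤-refl
  ... | _ | is-a₁ _ | _ | is-a₂ _ = ⊥-elim (c₁≰c₂ ιu⊑ιv)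
  ... | _ | is-a₁ refl | _ | is-high _ _ = from-c₁ ιu⊑ιv
    where
    from-c₁ : c₁ L.≤ c₁ × a₁ U.≤ v ⊎ c₁ L.≤ c₂ × a₂ U.≤ v → a₁ U.≤ v
    from-c₁ (inj₁ (_ , a₁≤v)) = a₁≤v
    from-c₁ (inj₂ (c₁≤c₂ , _)) = ⊥-elim (c₁≰c₂ c₁≤c₂)
  ... | _ | is-a₂ _ | _ | is-a₁ _ = ⊥-elim (c₂≰c₁ ιu⊑ιv)
  ... | _ | is-a₂ refl | _ | is-a₂ refl = U.≤-refl
  ... | _ | is-a₂ refl | _ | is-high _ _ = from-c₂ ιu⊑ιv
    where
    from-c₂ : c₂ L.≤ c₁ × a₁ U.≤ v ⊎ c₂ L.≤ c₂ × a₂ U.≤ v → a₂ U.≤ v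
    from-c₂ (inj₁ (c₂≤c₁ , _)) = ⊥-elim (c₂≰c₁ c₂≤c₁)
    from-c₂ (inj₂ (_ , a₂≤v)) = a₂≤v
  ... | _ | is-high _ _ | _ | is-a₁ _ = ⊥-elim ιu⊑ιv
  ... | _ | is-high _ _ | _ | is-a₂ _ = ⊥-elim ιu⊑ιv
  ... | _ | is-high _ _ | _ | is-high _ _ = ιu⊑ιv

  step⇒⊑ : ∀ {p q} → Step p q → p ⊑ q
  step⇒⊑ (inj₁ (_ , _ , _ , _ , x≤y , refl , refl)) = x≤y
  step⇒⊑ (inj₂ (_ , _ , u≢⊥ , _ , u≤v , refl , refl)) = ιU-monotone u≢⊥ u≤v

  closure⇒⊑ : ∀ {p q} → TransClosure Step p q → p ⊑ q
  closure⇒⊑ [ s ] = step⇒⊑ s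
  closure⇒⊑ {p} {r} (_∷_ {y = q} s rest) = ⊑-trans p q r (step⇒⊑ s) (closure⇒⊑ rest)

  _≤ᴱ_ : Rel Elem 0ℓ
  p ≤ᴱ q = proj₁ p ⊑ proj₁ q

  -- steps inside L', inside U', and the two-step path x ≤ cᵢ = aᵢ ≤ v
  ⊑⇒closure : ∀ {p q : Elem} → p ≤ᴱ q → p ≤ₛ q
  ⊑⇒closure {inj₁ x , tx} {inj₁ y , ty} x≤y =
    [ inj₁ (x , y , valid⇒≢⊤ tx , valid⇒≢⊤ ty , x≤y , refl , refl) ]
  ⊑⇒closure {inj₂ u , tu} {inj₂ v , tv} u≤v =
    [ inj₂ (u , v , proj₁ (valid⇒High tu) , proj₁ (valid⇒High tv) , u≤v ,
            sym (ιU-high (valid⇒High tu)) , sym (ιU-high (valid⇒High tv))) ]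
  ⊑⇒closure {inj₁ x , tx} {inj₂ v , tv} (inj₁ (x≤c₁ , a₁≤v)) =
    inj₁ (x , c₁ , valid⇒≢⊤ tx , c₁≢⊤ , x≤c₁ , refl , refl) ∷
    [ inj₂ (a₁ , v , a₁≢⊥ , proj₁ (valid⇒High tv) , a₁≤v , sym ιU-a₁ , sym (ιU-high (valid⇒High tv))) ]
  ⊑⇒closure {inj₁ x , tx} {inj₂ v , tv} (inj₂ (x≤c₂ , a₂≤v)) =
    inj₁ (x , c₂ , valid⇒≢⊤ tx , c₂≢⊤ , x≤c₂ , refl , refl) ∷
    [ inj₂ (a₂ , v , a₂≢⊥ , proj₁ (valid⇒High tv) , a₂≤v , sym ιU-a₂ , sym (ιU-high (valid⇒High tv))) ]
  ⊑⇒closure {inj₂ _ , _} {inj₁ _ , _} ()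

  ≤ᴱ-antisym : ∀ {p q} → p ≤ᴱ q → q ≤ᴱ p → p ≡ q
  ≤ᴱ-antisym {inj₁ _ , _} {inj₁ _ , _} x≤y y≤x = Elem-≡ (cong inj₁ (L.antisym x≤y y≤x))
  ≤ᴱ-antisym {inj₂ _ , _} {inj₂ _ , _} u≤v v≤u = Elem-≡ (cong inj₂ (U.antisym u≤v v≤u))
  ≤ᴱ-antisym {inj₁ _ , _} {inj₂ _ , _} _ ()
  ≤ᴱ-antisym {inj₂ _ , _} {inj₁ _ , _} ()

  IsJoin : Elem → Elem → Elem → Set
  IsJoin p q j = p ≤ᴱ j × q ≤ᴱ j × (∀ z → p ≤ᴱ z → q ≤ᴱ z → j ≤ᴱ z)

  a₁∨a₂-High : High (a₁ U.∨ a₂)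
  a₁∨a₂-High = High-above-atoms (U.x≤x∨y a₁ a₂) (U.y≤x∨y a₁ a₂)

  lo-⊑-a₁∨a₂ : ∀ {x} → x ≢ ⊤L → inj₁ x ⊑ inj₂ (a₁ U.∨ a₂)
  lo-⊑-a₁∨a₂ {x} x≢⊤ with below-c₁-or-c₂ x x≢⊤
  ... | inj₁ x≤c₁ = inj₁ (x≤c₁ , U.x≤x∨y a₁ a₂)
  ... | inj₂ x≤c₂ = inj₂ (x≤c₂ , U.y≤x∨y a₁ a₂)

  ⊤L-⋢ : ∀ w → ¬ (inj₁ ⊤L ⊑ inj₂ w)
  ⊤L-⋢ w (inj₁ (⊤≤c₁ , _)) = c₁≢⊤ (L.antisym (≤⊤L c₁) ⊤≤c₁)
  ⊤L-⋢ w (inj₂ (⊤≤c₂ , _)) = c₂≢⊤ (L.antisym (≤⊤L c₂) ⊤≤c₂)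

  lo-pair-⊑ : ∀ {x y w} → inj₁ x ⊑ inj₂ w → inj₁ y ⊑ inj₂ w →
              inj₁ (x L.∨ y) ⊑ inj₂ w ⊎ (a₁ U.∨ a₂) U.≤ w
  lo-pair-⊑ (inj₁ (x≤c₁ , a₁≤w)) (inj₁ (y≤c₁ , _))   = inj₁ (inj₁ (L.∨-least x≤c₁ y≤c₁ , a₁≤w))
  lo-pair-⊑ (inj₂ (x≤c₂ , a₂≤w)) (inj₂ (y≤c₂ , _))   = inj₁ (inj₂ (L.∨-least x≤c₂ y≤c₂ , a₂≤w))
  lo-pair-⊑ (inj₁ (_ , a₁≤w))    (inj₂ (_ , a₂≤w))   = inj₂ (U.∨-least a₁≤w a₂≤w)
  lo-pair-⊑ (inj₂ (_ , a₂≤w))    (inj₁ (_ , a₁≤w))   = inj₂ (U.∨-least a₁≤w a₂≤w)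

  join-lo-lo : Fin (size L) → Fin (size L) → Elem
  join-lo-lo x y with (x L.∨ y) ≟ ⊤L
  ... | yes _     = hi (a₁ U.∨ a₂) a₁∨a₂-High
  ... | no x∨y≢⊤ = lo (x L.∨ y) x∨y≢⊤

  join-lo-lo-isJoin : ∀ x y tx ty → IsJoin (inj₁ x , tx) (inj₁ y , ty) (join-lo-lo x y)
  join-lo-lo-isJoin x y tx ty with (x L.∨ y) ≟ ⊤L
  ... | yes x∨y≡⊤ = lo-⊑-a₁∨a₂ (valid⇒≢⊤ tx) , lo-⊑-a₁∨a₂ (valid⇒≢⊤ ty) , least
    where
    least : ∀ z → inj₁ x ⊑ proj₁ z → inj₁ y ⊑ proj₁ z → inj₂ (a₁ U.∨ a₂) ⊑ proj₁ z
    least (inj₁ w , tw) x≤w y≤w =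
      valid⇒≢⊤ tw (L.antisym (≤⊤L w) (subst (L._≤ w) x∨y≡⊤ (L.∨-least x≤w y≤w)))
    least (inj₂ w , _) x⊑w y⊑w with lo-pair-⊑ x⊑w y⊑w
    ... | inj₁ x∨y⊑w   = ⊥-elim (⊤L-⋢ w (subst (λ t → inj₁ t ⊑ inj₂ w) x∨y≡⊤ x∨y⊑w))
    ... | inj₂ a₁∨a₂≤w = a₁∨a₂≤w
  ... | no x∨y≢⊤ = L.x≤x∨y x y , L.y≤x∨y x y , least
    where
    least : ∀ z → inj₁ x ⊑ proj₁ z → inj₁ y ⊑ proj₁ z → inj₁ (x L.∨ y) ⊑ proj₁ z
    least (inj₁ w , _) x≤w y≤w = L.∨-least x≤w y≤w
    least (inj₂ w , _) x⊑w y⊑w with lo-pair-⊑ x⊑w y⊑w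
    ... | inj₁ x∨y⊑w   = x∨y⊑w
    ... | inj₂ a₁∨a₂≤w = ⊑-trans (inj₁ _) (inj₂ _) (inj₂ w) (lo-⊑-a₁∨a₂ x∨y≢⊤) a₁∨a₂≤w

  join-lo-hi : Fin (size L) → (v : Fin (size U)) → High v → Elem
  join-lo-hi x v hv with x L.≤? c₁ | x L.≤? c₂
  ... | yes _ | yes _ = hi v hv
  ... | yes _ | no _  = hi (a₁ U.∨ v) (High-upward hv (U.y≤x∨y a₁ v))
  ... | no _  | _     = hi (a₂ U.∨ v) (High-upward hv (U.y≤x∨y a₂ v))

  join-lo-hi-isJoin : ∀ x v tx tv → IsJoin (inj₁ x , tx) (inj₂ v , tv) (join-lo-hi x v (valid⇒High tv))
  join-lo-hi-isJoin x v tx tv with x L.≤? c₁ | x L.≤? c₂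
  ... | yes x≤c₁ | yes x≤c₂ = x⊑v , U.≤-refl , λ _ _ v⊑z → v⊑z
    where
    x⊑v : inj₁ x ⊑ inj₂ v
    x⊑v with above-a₁-or-a₂ v (proj₁ (valid⇒High tv))
    ... | inj₁ a₁≤v = inj₁ (x≤c₁ , a₁≤v)
    ... | inj₂ a₂≤v = inj₂ (x≤c₂ , a₂≤v)
  ... | yes x≤c₁ | no x≰c₂ = inj₁ (x≤c₁ , U.x≤x∨y a₁ v) , U.y≤x∨y a₁ v , least
    where
    least : ∀ z → inj₁ x ⊑ proj₁ z → inj₂ v ⊑ proj₁ z → inj₂ (a₁ U.∨ v) ⊑ proj₁ z
    least (inj₁ _ , _) _ ()
    least (inj₂ w , _) (inj₁ (_ , a₁≤w)) v≤w = U.∨-least a₁≤w v≤w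
    least (inj₂ w , _) (inj₂ (x≤c₂ , _)) _   = ⊥-elim (x≰c₂ x≤c₂)
  ... | no x≰c₁ | _ = x⊑a₂∨v , U.y≤x∨y a₂ v , least
    where
    x⊑a₂∨v : inj₁ x ⊑ inj₂ (a₂ U.∨ v)
    x⊑a₂∨v with below-c₁-or-c₂ x (valid⇒≢⊤ tx)
    ... | inj₁ x≤c₁ = ⊥-elim (x≰c₁ x≤c₁)
    ... | inj₂ x≤c₂ = inj₂ (x≤c₂ , U.x≤x∨y a₂ v)
    least : ∀ z → inj₁ x ⊑ proj₁ z → inj₂ v ⊑ proj₁ z → inj₂ (a₂ U.∨ v) ⊑ proj₁ z
    least (inj₁ _ , _) _ ()
    least (inj₂ w , _) (inj₁ (x≤c₁ , _)) _   = ⊥-elim (x≰c₁ x≤c₁)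
    least (inj₂ w , _) (inj₂ (_ , a₂≤w)) v≤w = U.∨-least a₂≤w v≤w

  _∨ᴱ_ : Elem → Elem → Elem
  (inj₁ x , _)  ∨ᴱ (inj₁ y , _)  = join-lo-lo x y
  (inj₁ x , _)  ∨ᴱ (inj₂ v , tv) = join-lo-hi x v (valid⇒High tv)
  (inj₂ v , tv) ∨ᴱ (inj₁ x , _)  = join-lo-hi x v (valid⇒High tv)
  (inj₂ u , tu) ∨ᴱ (inj₂ v , _)  = hi (u U.∨ v) (High-upward (valid⇒High tu) (U.x≤x∨y u v))

  ∨ᴱ-isJoin : ∀ p q → IsJoin p q (p ∨ᴱ q)
  ∨ᴱ-isJoin (inj₁ x , tx) (inj₁ y , ty) = join-lo-lo-isJoin x y tx ty
  ∨ᴱ-isJoin (inj₁ x , tx) (inj₂ v , tv) = join-lo-hi-isJoin x v tx tv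
  ∨ᴱ-isJoin (inj₂ v , tv) (inj₁ x , tx) =
    let x⊑j , v⊑j , least = join-lo-hi-isJoin x v tx tv
    in v⊑j , x⊑j , λ z v⊑z x⊑z → least z x⊑z v⊑z
  ∨ᴱ-isJoin (inj₂ u , _) (inj₂ v , _) = U.x≤x∨y u v , U.y≤x∨y u v , least
    where
    least : ∀ z → inj₂ u ⊑ proj₁ z → inj₂ v ⊑ proj₁ z → inj₂ (u U.∨ v) ⊑ proj₁ z
    least (inj₁ _ , _) ()
    least (inj₂ _ , _) u≤w v≤w = U.∨-least u≤w v≤w

  IsMeet : Elem → Elem → Elem → Set
  IsMeet p q m = m ≤ᴱ p × m ≤ᴱ q × (∀ z → z ≤ᴱ p → z ≤ᴱ q → z ≤ᴱ m)

  c₁∧c₂≢⊤ : (c₁ L.∧ c₂) ≢ ⊤L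
  c₁∧c₂≢⊤ = ≢⊤-downward c₁≢⊤ (L.x∧y≤x c₁ c₂)

  c₁∧c₂-⊑ : ∀ {t} → t ≢ ⊥U → inj₁ (c₁ L.∧ c₂) ⊑ inj₂ t
  c₁∧c₂-⊑ {t} t≢⊥ with above-a₁-or-a₂ t t≢⊥
  ... | inj₁ a₁≤t = inj₁ (L.x∧y≤x c₁ c₂ , a₁≤t)
  ... | inj₂ a₂≤t = inj₂ (L.x∧y≤y c₁ c₂ , a₂≤t)

  lo-⊑-pair : ∀ {w u v} → inj₁ w ⊑ inj₂ u → inj₁ w ⊑ inj₂ v →
              inj₁ w ⊑ inj₂ (u U.∧ v) ⊎ w L.≤ (c₁ L.∧ c₂)
  lo-⊑-pair (inj₁ (w≤c₁ , a₁≤u)) (inj₁ (_ , a₁≤v))    = inj₁ (inj₁ (w≤c₁ , U.∧-greatest a₁≤u a₁≤v))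
  lo-⊑-pair (inj₂ (w≤c₂ , a₂≤u)) (inj₂ (_ , a₂≤v))    = inj₁ (inj₂ (w≤c₂ , U.∧-greatest a₂≤u a₂≤v))
  lo-⊑-pair (inj₁ (w≤c₁ , _))    (inj₂ (w≤c₂ , _))    = inj₂ (L.∧-greatest w≤c₁ w≤c₂)
  lo-⊑-pair (inj₂ (w≤c₂ , _))    (inj₁ (w≤c₁ , _))    = inj₂ (L.∧-greatest w≤c₁ w≤c₂)

  lo-⊑-ιU : ∀ {w m} → m ≢ ⊥U → inj₁ w ⊑ inj₂ m → inj₁ w ⊑ ιU m
  lo-⊑-ιU {w} {m} m≢⊥ (inj₁ (w≤c₁ , a₁≤m)) =
    ⊑-trans (inj₁ w) (ιU a₁) (ιU m) (subst (inj₁ w ⊑_) (sym ιU-a₁) w≤c₁) (ιU-monotone a₁≢⊥ a₁≤m)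
  lo-⊑-ιU {w} {m} m≢⊥ (inj₂ (w≤c₂ , a₂≤m)) =
    ⊑-trans (inj₁ w) (ιU a₂) (ιU m) (subst (inj₁ w ⊑_) (sym ιU-a₂) w≤c₂) (ιU-monotone a₂≢⊥ a₂≤m)

  meet-lo-hi : (x : Fin (size L)) → x ≢ ⊤L → Fin (size U) → Elem
  meet-lo-hi x x≢⊤ v with a₁ U.≤? v | a₂ U.≤? v
  ... | yes _ | yes _ = lo x x≢⊤
  ... | yes _ | no _  = lo (x L.∧ c₁) (≢⊤-downward x≢⊤ (L.x∧y≤x x c₁))
  ... | no _  | _     = lo (x L.∧ c₂) (≢⊤-downward x≢⊤ (L.x∧y≤x x c₂))

  meet-lo-hi-isMeet : ∀ x v tx tv → IsMeet (inj₁ x , tx) (inj₂ v , tv) (meet-lo-hi x (valid⇒≢⊤ tx) v)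
  meet-lo-hi-isMeet x v tx tv with a₁ U.≤? v | a₂ U.≤? v
  ... | yes a₁≤v | yes a₂≤v = L.≤-refl , x⊑v , λ _ z⊑x _ → z⊑x
    where
    x⊑v : inj₁ x ⊑ inj₂ v
    x⊑v with below-c₁-or-c₂ x (valid⇒≢⊤ tx)
    ... | inj₁ x≤c₁ = inj₁ (x≤c₁ , a₁≤v)
    ... | inj₂ x≤c₂ = inj₂ (x≤c₂ , a₂≤v)
  ... | yes a₁≤v | no a₂≰v = L.x∧y≤x x c₁ , inj₁ (L.x∧y≤y x c₁ , a₁≤v) , greatest
    where
    greatest : ∀ z → proj₁ z ⊑ inj₁ x → proj₁ z ⊑ inj₂ v → proj₁ z ⊑ inj₁ (x L.∧ c₁)
    greatest (inj₂ _ , _) ()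
    greatest (inj₁ _ , _) w≤x (inj₁ (w≤c₁ , _)) = L.∧-greatest w≤x w≤c₁
    greatest (inj₁ _ , _) _   (inj₂ (_ , a₂≤v)) = ⊥-elim (a₂≰v a₂≤v)
  ... | no a₁≰v | _ = L.x∧y≤x x c₂ , inj₂ (L.x∧y≤y x c₂ , a₂≤v) , greatest
    where
    a₂≤v : a₂ U.≤ v
    a₂≤v with above-a₁-or-a₂ v (proj₁ (valid⇒High tv))
    ... | inj₁ a₁≤v = ⊥-elim (a₁≰v a₁≤v)
    ... | inj₂ a₂≤v = a₂≤v
    greatest : ∀ z → proj₁ z ⊑ inj₁ x → proj₁ z ⊑ inj₂ v → proj₁ z ⊑ inj₁ (x L.∧ c₂)
    greatest (inj₂ _ , _) ()
    greatest (inj₁ _ , _) _   (inj₁ (_ , a₁≤v)) = ⊥-elim (a₁≰v a₁≤v)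
    greatest (inj₁ _ , _) w≤x (inj₂ (w≤c₂ , _)) = L.∧-greatest w≤x w≤c₂

  meet-hi-hi : Fin (size U) → Fin (size U) → Elem
  meet-hi-hi u v with (u U.∧ v) ≟ ⊥U
  ... | yes _     = lo (c₁ L.∧ c₂) c₁∧c₂≢⊤
  ... | no u∧v≢⊥ = ιE (u U.∧ v) u∧v≢⊥

  meet-hi-hi-isMeet : ∀ u v tu tv → IsMeet (inj₂ u , tu) (inj₂ v , tv) (meet-hi-hi u v)
  meet-hi-hi-isMeet u v tu tv with (u U.∧ v) ≟ ⊥U
  ... | yes u∧v≡⊥ =
    c₁∧c₂-⊑ (proj₁ (valid⇒High tu)) , c₁∧c₂-⊑ (proj₁ (valid⇒High tv)) , greatest
    where
    below-u∧v⇒⊥ : ∀ {w} → w U.≤ (u U.∧ v) → w ≡ ⊥U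
    below-u∧v⇒⊥ w≤u∧v = U.antisym (subst (_ U.≤_) u∧v≡⊥ w≤u∧v) (⊥U≤ _)
    greatest : ∀ z → proj₁ z ⊑ inj₂ u → proj₁ z ⊑ inj₂ v → proj₁ z ⊑ inj₁ (c₁ L.∧ c₂)
    greatest (inj₂ w , tw) w≤u w≤v = proj₁ (valid⇒High tw) (below-u∧v⇒⊥ (U.∧-greatest w≤u w≤v))
    greatest (inj₁ w , _) w⊑u w⊑v with lo-⊑-pair w⊑u w⊑v
    ... | inj₁ (inj₁ (_ , a₁≤u∧v)) = ⊥-elim (a₁≢⊥ (below-u∧v⇒⊥ a₁≤u∧v))
    ... | inj₁ (inj₂ (_ , a₂≤u∧v)) = ⊥-elim (a₂≢⊥ (below-u∧v⇒⊥ a₂≤u∧v))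
    ... | inj₂ w≤c₁∧c₂ = w≤c₁∧c₂
  ... | no u∧v≢⊥ = below (valid⇒High tu) (U.x∧y≤x u v) , below (valid⇒High tv) (U.x∧y≤y u v) , greatest
    where
    below : ∀ {t} → High t → (u U.∧ v) U.≤ t → ιU (u U.∧ v) ⊑ inj₂ t
    below ht u∧v≤t = subst (ιU (u U.∧ v) ⊑_) (ιU-high ht) (ιU-monotone u∧v≢⊥ u∧v≤t)
    greatest : ∀ z → proj₁ z ⊑ inj₂ u → proj₁ z ⊑ inj₂ v → proj₁ z ⊑ ιU (u U.∧ v)
    greatest (inj₂ w , tw) w≤u w≤v =
      subst (_⊑ ιU (u U.∧ v)) (ιU-high (valid⇒High tw))
            (ιU-monotone (proj₁ (valid⇒High tw)) (U.∧-greatest w≤u w≤v))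
    greatest (inj₁ w , _) w⊑u w⊑v with lo-⊑-pair w⊑u w⊑v
    ... | inj₁ w⊑u∧v   = lo-⊑-ιU u∧v≢⊥ w⊑u∧v
    ... | inj₂ w≤c₁∧c₂ = lo-⊑-ιU u∧v≢⊥ (⊑-trans (inj₁ w) (inj₁ _) (inj₂ _) w≤c₁∧c₂ (c₁∧c₂-⊑ u∧v≢⊥))

  _∧ᴱ_ : Elem → Elem → Elem
  (inj₁ x , tx) ∧ᴱ (inj₁ y , _)  = lo (x L.∧ y) (≢⊤-downward (valid⇒≢⊤ tx) (L.x∧y≤x x y))
  (inj₁ x , tx) ∧ᴱ (inj₂ v , _)  = meet-lo-hi x (valid⇒≢⊤ tx) v
  (inj₂ v , _)  ∧ᴱ (inj₁ x , tx) = meet-lo-hi x (valid⇒≢⊤ tx) v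
  (inj₂ u , _)  ∧ᴱ (inj₂ v , _)  = meet-hi-hi u v

  ∧ᴱ-isMeet : ∀ p q → IsMeet p q (p ∧ᴱ q)
  ∧ᴱ-isMeet (inj₁ x , _) (inj₁ y , _) = L.x∧y≤x x y , L.x∧y≤y x y , greatest
    where
    greatest : ∀ z → proj₁ z ⊑ inj₁ x → proj₁ z ⊑ inj₁ y → proj₁ z ⊑ inj₁ (x L.∧ y)
    greatest (inj₂ _ , _) ()
    greatest (inj₁ _ , _) w≤x w≤y = L.∧-greatest w≤x w≤y
  ∧ᴱ-isMeet (inj₁ x , tx) (inj₂ v , tv) = meet-lo-hi-isMeet x v tx tv
  ∧ᴱ-isMeet (inj₂ v , tv) (inj₁ x , tx) =
    let m⊑x , m⊑v , greatest = meet-lo-hi-isMeet x v tx tv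
    in m⊑v , m⊑x , λ z z⊑v z⊑x → greatest z z⊑x z⊑v
  ∧ᴱ-isMeet (inj₂ u , tu) (inj₂ v , tv) = meet-hi-hi-isMeet u v tu tv

  ≤ᴱ-isLattice : IsLattice _≡_ _≤ᴱ_ _∨ᴱ_ _∧ᴱ_
  ≤ᴱ-isLattice = record
    { isPartialOrder = record
      { isPreorder = record
        { isEquivalence = Eq.isEquivalence
        ; reflexive     = λ { {p} refl → ⊑-refl (proj₁ p) }
        ; trans         = λ {p} {q} {r} → ⊑-trans (proj₁ p) (proj₁ q) (proj₁ r)
        }
      ; antisym = ≤ᴱ-antisym
      }
    ; supremum = ∨ᴱ-isJoin
    ; infimum  = ∧ᴱ-isMeet
    }

  _<ᴱ_ : Rel Elem 0ℓ
  _<ᴱ_ = _<_ _≤ᴱ_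

  _⋖ᴱ_ : Rel Elem 0ℓ
  _⋖ᴱ_ = Covers _≤ᴱ_

  -- the lower elements form a down-set ordered as in L, so covers among them are covers of L
  lo-⋖⇒L : ∀ {m x tm tx} → (inj₁ m , tm) ⋖ᴱ (inj₁ x , tx) → m L.⋖ x
  lo-⋖⇒L {tx = tx} ((m≤x , m≢x) , between) =
    (m≤x , m≢x ∘ Elem-≡ ∘ cong inj₁) , λ z (m≤z , m≢z) (z≤x , z≢x) →
      between (lo z (≢⊤-downward (valid⇒≢⊤ tx) z≤x))
              (m≤z , m≢z ∘ inj₁-injective ∘ cong proj₁) (z≤x , z≢x ∘ inj₁-injective ∘ cong proj₁)

  L-⋖⇒lo : ∀ {x y tx ty} → x L.⋖ y → (inj₁ x , tx) ⋖ᴱ (inj₁ y , ty)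
  L-⋖⇒lo {x} {y} {tx} {ty} ((x≤y , x≢y) , between) =
    (x≤y , x≢y ∘ inj₁-injective ∘ cong proj₁) , strictly-between
    where
    strictly-between : ∀ z → (inj₁ x , tx) <ᴱ z → ¬ (z <ᴱ (inj₁ y , ty))
    strictly-between (inj₁ w , _) (x≤w , x≢w) (w≤y , w≢y) =
      between w (x≤w , x≢w ∘ Elem-≡ ∘ cong inj₁) (w≤y , w≢y ∘ Elem-≡ ∘ cong inj₁)
    strictly-between (inj₂ _ , _) _ (() , _)

  ιU-injective : ∀ {u v} → ιU u ≡ ιU v → u ≡ v
  ιU-injective {u} ιu≡ιv = U.antisym (ιU-reflects (subst (ιU u ⊑_) ιu≡ιv (⊑-refl (ιU u))))
                                     (ιU-reflects (subst (_⊑ ιU u) ιu≡ιv (⊑-refl (ιU u))))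

  above-ιU : ∀ {u} (z : Elem) → ιU u ⊑ proj₁ z → ∃[ w ] w ≢ ⊥U × proj₁ z ≡ ιU w
  above-ιU (inj₂ w , tw) _ = w , proj₁ (valid⇒High tw) , sym (ιU-high (valid⇒High tw))
  above-ιU {u} (inj₁ w , tw) ιu⊑w with ιU u | ιU-view u
  ... | _ | is-a₁ _ = a₁ , a₁≢⊥ , trans (cong inj₁ (coatom-maximal c₁⋖⊤ ιu⊑w (valid⇒≢⊤ tw))) (sym ιU-a₁)
  ... | _ | is-a₂ _ = a₂ , a₂≢⊥ , trans (cong inj₁ (coatom-maximal c₂⋖⊤ ιu⊑w (valid⇒≢⊤ tw))) (sym ιU-a₂)
  ... | _ | is-high _ _ = ⊥-elim ιu⊑w

  -- ιU is an order embedding onto an up-set, so it preserves and reflects covers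
  ι-⋖⇒U : ∀ {m u} (m≢⊥ : m ≢ ⊥U) (u≢⊥ : u ≢ ⊥U) → ιE m m≢⊥ ⋖ᴱ ιE u u≢⊥ → m U.⋖ u
  ι-⋖⇒U {m} {u} m≢⊥ u≢⊥ ((ιm⊑ιu , m≢u) , between) =
    (ιU-reflects ιm⊑ιu , m≢u ∘ Elem-≡ ∘ cong ιU) , λ z (m≤z , m≢z) (z≤u , z≢u) →
      let z≢⊥ : z ≢ ⊥U
          z≢⊥ = λ { refl → m≢⊥ (U.antisym m≤z (⊥U≤ m)) }
      in between (ιE z z≢⊥)
                 (ιU-monotone m≢⊥ m≤z , m≢z ∘ ιU-injective ∘ cong proj₁)
                 (ιU-monotone z≢⊥ z≤u , z≢u ∘ ιU-injective ∘ cong proj₁)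

  U-⋖⇒ι : ∀ {u v} (u≢⊥ : u ≢ ⊥U) (v≢⊥ : v ≢ ⊥U) → u U.⋖ v → ιE u u≢⊥ ⋖ᴱ ιE v v≢⊥
  U-⋖⇒ι {u} {v} u≢⊥ v≢⊥ ((u≤v , u≢v) , between) =
    (ιU-monotone u≢⊥ u≤v , u≢v ∘ ιU-injective ∘ cong proj₁) , strictly-between
    where
    strictly-between : ∀ z → ιE u u≢⊥ <ᴱ z → ¬ (z <ᴱ ιE v v≢⊥)
    strictly-between z (ιu⊑z , ιu≢z) (z⊑ιv , z≢ιv) with above-ιU {u} z ιu⊑z
    ... | w , _ , z≡ιw =
      between w (ιU-reflects (subst (ιU u ⊑_) z≡ιw ιu⊑z) , λ { refl → ιu≢z (Elem-≡ (sym z≡ιw)) })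
                (ιU-reflects (subst (_⊑ ιU v) z≡ιw z⊑ιv) , λ { refl → z≢ιv (Elem-≡ z≡ιw) })

  -- a lower element covered by a high one is a coatom: otherwise cᵢ lies strictly between
  lo-⋖-hi⇒coatom : ∀ {m tm v tv} → (inj₁ m , tm) ⋖ᴱ (inj₂ v , tv) → m ≡ c₁ ⊎ m ≡ c₂
  lo-⋖-hi⇒coatom {m} ((inj₁ (m≤c₁ , a₁≤v) , _) , between) with m ≟ c₁
  ... | yes m≡c₁ = inj₁ m≡c₁
  ... | no m≢c₁ = ⊥-elim (between (lo c₁ c₁≢⊤) (m≤c₁ , m≢c₁ ∘ inj₁-injective ∘ cong proj₁)
                                              (inj₁ (L.≤-refl , a₁≤v) , λ ()))
  lo-⋖-hi⇒coatom {m} ((inj₂ (m≤c₂ , a₂≤v) , _) , between) with m ≟ c₂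
  ... | yes m≡c₂ = inj₂ m≡c₂
  ... | no m≢c₂ = ⊥-elim (between (lo c₂ c₂≢⊤) (m≤c₂ , m≢c₂ ∘ inj₁-injective ∘ cong proj₁)
                                              (inj₂ (L.≤-refl , a₂≤v) , λ ()))

  -- no element is covered both by a lower and by a high element, since a
  -- coatom cᵢ is covered by no lower element
  no-mixed-covers : ∀ p {x tx v tv} → p ⋖ᴱ (inj₁ x , tx) → p ⋖ᴱ (inj₂ v , tv) → ⊥
  no-mixed-covers (inj₂ _ , _) ((() , _) , _) _
  no-mixed-covers (inj₁ m , _) {x} {tx} m⋖x m⋖v with lo-⋖-hi⇒coatom m⋖v | lo-⋖⇒L m⋖x
  ... | inj₁ refl | (c₁≤x , c₁≢x) , _ = c₁≢x (sym (coatom-maximal c₁⋖⊤ c₁≤x (valid⇒≢⊤ tx)))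
  ... | inj₂ refl | (c₂≤x , c₂≢x) , _ = c₂≢x (sym (coatom-maximal c₂⋖⊤ c₂≤x (valid⇒≢⊤ tx)))

  atoms-⋖-a₁∨a₂ : a₁ U.⋖ (a₁ U.∨ a₂) × a₂ U.⋖ (a₁ U.∨ a₂)
  atoms-⋖-a₁∨a₂ = smU a₁ a₂ (subst (U._⋖ a₁) (sym a₁∧a₂≡⊥) ⊥⋖a₁) (subst (U._⋖ a₂) (sym a₁∧a₂≡⊥) ⊥⋖a₂)
    where
    a₁∧a₂≡⊥ : (a₁ U.∧ a₂) ≡ ⊥U
    a₁∧a₂≡⊥ = atoms-meet ⊥⋖a₁ ⊥⋖a₂ a₁≢a₂

  a₁∨a₂-as-ιE : ιE (a₁ U.∨ a₂) (proj₁ a₁∨a₂-High) ≡ hi (a₁ U.∨ a₂) a₁∨a₂-High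
  a₁∨a₂-as-ιE = Elem-≡ (ιU-high a₁∨a₂-High)

  c₁-⋖-a₁∨a₂ : ∀ t → (inj₁ c₁ , t) ⋖ᴱ hi (a₁ U.∨ a₂) a₁∨a₂-High
  c₁-⋖-a₁∨a₂ t = subst₂ _⋖ᴱ_ (Elem-≡ {ιE a₁ a₁≢⊥} ιU-a₁) a₁∨a₂-as-ιE
                        (U-⋖⇒ι a₁≢⊥ (proj₁ a₁∨a₂-High) (proj₁ atoms-⋖-a₁∨a₂))

  c₂-⋖-a₁∨a₂ : ∀ t → (inj₁ c₂ , t) ⋖ᴱ hi (a₁ U.∨ a₂) a₁∨a₂-High
  c₂-⋖-a₁∨a₂ t = subst₂ _⋖ᴱ_ (Elem-≡ {ιE a₂ a₂≢⊥} ιU-a₂) a₁∨a₂-as-ιE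
                        (U-⋖⇒ι a₂≢⊥ (proj₁ a₁∨a₂-High) (proj₂ atoms-⋖-a₁∨a₂))

  -- semimodularity for two lower elements: from semimodularity of L, unless
  -- x ∨ y = ⊤L, in which case x, y are the two coatoms and a₁ ∨ a₂ covers both
  lo-pair-semimodular : ∀ x y tx ty → (x L.∧ y) L.⋖ x → (x L.∧ y) L.⋖ y →
                        (inj₁ x , tx) ⋖ᴱ join-lo-lo x y × (inj₁ y , ty) ⋖ᴱ join-lo-lo x y
  lo-pair-semimodular x y tx ty x∧y⋖x x∧y⋖y with smL x y x∧y⋖x x∧y⋖y | (x L.∨ y) ≟ ⊤L
  ... | x⋖x∨y , y⋖x∨y | no _ = L-⋖⇒lo x⋖x∨y , L-⋖⇒lo y⋖x∨y
  ... | x⋖x∨y , y⋖x∨y | yes x∨y≡⊤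
    with coatoms x (subst (x L.⋖_) x∨y≡⊤ x⋖x∨y) | coatoms y (subst (y L.⋖_) x∨y≡⊤ y⋖x∨y)
  ...   | inj₁ refl | inj₁ refl = ⊥-elim (L.¬self-meet-⋖ x x∧y⋖x)
  ...   | inj₂ refl | inj₂ refl = ⊥-elim (L.¬self-meet-⋖ x x∧y⋖x)
  ...   | inj₁ refl | inj₂ refl = c₁-⋖-a₁∨a₂ tx , c₂-⋖-a₁∨a₂ ty
  ...   | inj₂ refl | inj₁ refl = c₂-⋖-a₁∨a₂ tx , c₁-⋖-a₁∨a₂ ty

  high-as-ιE : ∀ {u} (tu : T (valid (inj₂ u))) → ιE u (proj₁ (valid⇒High tu)) ≡ (inj₂ u , tu)
  high-as-ιE tu = Elem-≡ (ιU-high (valid⇒High tu))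

  -- semimodularity for two high elements: u ∧ v cannot be ⊥U, since c₁ ∧ c₂ is
  -- covered by no high element; so it is semimodularity of U transported along ιU
  hi-pair-semimodular : ∀ u v tu tv →
                        meet-hi-hi u v ⋖ᴱ (inj₂ u , tu) → meet-hi-hi u v ⋖ᴱ (inj₂ v , tv) →
                        (inj₂ u , tu) ⋖ᴱ ((inj₂ u , tu) ∨ᴱ (inj₂ v , tv)) ×
                        (inj₂ v , tv) ⋖ᴱ ((inj₂ u , tu) ∨ᴱ (inj₂ v , tv))
  hi-pair-semimodular u v tu tv m⋖u m⋖v with (u U.∧ v) ≟ ⊥U
  ... | yes _ with lo-⋖-hi⇒coatom m⋖u
  ...   | inj₁ c₁∧c₂≡c₁ = ⊥-elim (c₁≰c₂ (subst (L._≤ c₂) c₁∧c₂≡c₁ (L.x∧y≤y c₁ c₂)))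
  ...   | inj₂ c₁∧c₂≡c₂ = ⊥-elim (c₂≰c₁ (subst (L._≤ c₁) c₁∧c₂≡c₂ (L.x∧y≤x c₁ c₂)))
  hi-pair-semimodular u v tu tv m⋖u m⋖v | no u∧v≢⊥ =
    let u⋖u∨v , v⋖u∨v = smU u v (ι-⋖⇒U u∧v≢⊥ u≢⊥ (subst (m ⋖ᴱ_) (sym (high-as-ιE tu)) m⋖u))
                                (ι-⋖⇒U u∧v≢⊥ v≢⊥ (subst (m ⋖ᴱ_) (sym (high-as-ιE tv)) m⋖v))
    in subst₂ _⋖ᴱ_ (high-as-ιE tu) (high-as-ιE tu∨v) (U-⋖⇒ι u≢⊥ u∨v≢⊥ u⋖u∨v) ,
       subst₂ _⋖ᴱ_ (high-as-ιE tv) (high-as-ιE tu∨v) (U-⋖⇒ι v≢⊥ u∨v≢⊥ v⋖u∨v)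
    where
    m : Elem
    m = ιE (u U.∧ v) u∧v≢⊥
    tu∨v : T (valid (inj₂ (u U.∨ v)))
    tu∨v = proj₂ ((inj₂ u , tu) ∨ᴱ (inj₂ v , tv))
    u≢⊥ : u ≢ ⊥U
    u≢⊥ = proj₁ (valid⇒High tu)
    v≢⊥ : v ≢ ⊥U
    v≢⊥ = proj₁ (valid⇒High tv)
    u∨v≢⊥ : (u U.∨ v) ≢ ⊥U
    u∨v≢⊥ = proj₁ (valid⇒High tu∨v)

  ≤ᴱ-semimodular : SemimodularOps _≤ᴱ_ _∨ᴱ_ _∧ᴱ_
  ≤ᴱ-semimodular (inj₁ x , tx) (inj₁ y , ty) m⋖x m⋖y =
    lo-pair-semimodular x y tx ty (lo-⋖⇒L m⋖x) (lo-⋖⇒L m⋖y)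
  ≤ᴱ-semimodular (inj₁ _ , _)  (inj₂ _ , _)  m⋖x m⋖v = ⊥-elim (no-mixed-covers _ m⋖x m⋖v)
  ≤ᴱ-semimodular (inj₂ _ , _)  (inj₁ _ , _)  m⋖v m⋖x = ⊥-elim (no-mixed-covers _ m⋖x m⋖v)
  ≤ᴱ-semimodular (inj₂ u , tu) (inj₂ v , tv) m⋖u m⋖v = hi-pair-semimodular u v tu tv m⋖u m⋖v

  ≤ᴱ-semimodularLattice : IsSemimodularLattice _≤ᴱ_
  ≤ᴱ-semimodularLattice = _∨ᴱ_ , _∧ᴱ_ , ≤ᴱ-isLattice , ≤ᴱ-semimodular

lemma11 : (L U : FinLattice) → Semimodular L → Semimodular U →
    (⊤L c₁ c₂ : Fin (size L)) →
    (∀ x → FinLattice._≤_ L x ⊤L) →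
    c₁ ≢ c₂ →
    Covers (FinLattice._≤_ L) c₁ ⊤L → Covers (FinLattice._≤_ L) c₂ ⊤L →
    (∀ c → Covers (FinLattice._≤_ L) c ⊤L → c ≡ c₁ ⊎ c ≡ c₂) →
    (⊥U a₁ a₂ : Fin (size U)) →
    (∀ y → FinLattice._≤_ U ⊥U y) →
    a₁ ≢ a₂ →
    Covers (FinLattice._≤_ U) ⊥U a₁ → Covers (FinLattice._≤_ U) ⊥U a₂ →
    (∀ a → Covers (FinLattice._≤_ U) ⊥U a → a ≡ a₁ ⊎ a ≡ a₂) →
    IsSemimodularLattice (VerticalSum._≤ₛ_ L U ⊤L c₁ c₂ ⊥U a₁ a₂)
lemma11 L U smL smU ⊤L c₁ c₂ ≤⊤L c₁≢c₂ c₁⋖⊤ c₂⋖⊤ coatoms ⊥U a₁ a₂ ⊥U≤ a₁≢a₂ ⊥⋖a₁ ⊥⋖a₂ atoms =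
  semimodularLattice-transport (λ {p} {q} → ⊑⇒closure {p} {q})
                               (λ {p} {q} → closure⇒⊑ {proj₁ p} {proj₁ q})
                               ≤ᴱ-semimodularLattice
  where
  open VerticalSumProperties L U smL smU ⊤L c₁ c₂ ≤⊤L c₁≢c₂ c₁⋖⊤ c₂⋖⊤ coatoms
                             ⊥U a₁ a₂ ⊥U≤ a₁≢a₂ ⊥⋖a₁ ⊥⋖a₂ atoms
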